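{- Let $P = \frac{p_1}{q_1},\ldots,\frac{p_k}{q_k}$ be a Fractran program, $d = \mathrm{lcm}(q_1,\ldots,q_k)$, and for $n = 1,\ldots,d$ let $a'_n$, $b_n$ and $\varphi$ be as in the context. Then for every integer $n>0$, $$f_P(n) = \left\lfloor \frac{n-1}{d}\right\rfloor\cdot a'_{\varphi(n)} + b_{\varphi(n)},$$ where both sides are undefined simultaneously (with the convention that $m\cdot a'_j$ is undefined whenever $a'_j$ is undefined).
   Context: A Fractran program is a finite list $P$ of positive rationals $\frac{p_1}{q_1},\ldots,\frac{p_k}{q_k}$; $f_P(n) = n\cdot\frac{p_i}{q_i}$ for the first $i$ (in list order) with $n\cdot\frac{p_i}{q_i}\in\mathbb{N}$, and $f_P(n)$ is undefined if no such $i$ exists. For $n=1,\ldots,d$: if $\frac{p_i}{q_i}$ is the first fraction of $P$ with $n\cdot\frac{p_i}{q_i}\in\mathbb{N}$, put $a'_n = p_i\cdot(d/q_i)$ and $b_n = n\cdot\frac{p_i}{q_i}$; if no such fraction exists, $a'_n$ and $b_n$ are undefined. For $n\in\mathbb{N}$, $\varphi(n)$ denotes the unique number in $\{1,\ldots,d\}$ with $n\equiv\varphi(n) \pmod d$. -}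

module Defs where

open import Data.Nat using (ℕ; zero; suc; _+_; _*_; _∸_; NonZero; ≢-nonZero; ≢-nonZero⁻¹)
open import Data.Nat.Properties using (m*n≢0)
open import Data.Nat.DivMod using (_/_; _%_)
open import Data.Nat.Divisibility using (_∣_; _∣?_; ∣-trans; m∣m*n; n∣m*n; 0∣⇒≡0)
open import Data.Nat.LCM using (lcm; lcm-least)
open import Data.List using (List; []; _∷_; foldr)
open import Data.Maybe using (Maybe; just; nothing)
open import Relation.Nullary using (yes; no)
open import Relation.Binary.PropositionalEquality using (_≡_)

record Frac : Set where
  constructor _//_
  field
    num : ℕ
    den : ℕ
    {{num-nz}} : NonZero num
    {{den-nz}} : NonZero den
open Frac public

Program : Set
Program = List Frac

-- n · p/q ∈ ℕ  iff  q ∣ n * p.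
-- The first fraction of P with n·(p/q) ∈ ℕ, if any.
firstFrac : Program → ℕ → Maybe Frac
firstFrac [] n = nothing
firstFrac (r ∷ P) n with den r ∣? (n * num r)
... | yes _ = just r
... | no  _ = firstFrac P n

-- n · p/q as a natural number (meaningful when q ∣ n * p).
apply : Frac → ℕ → ℕ
apply r n = ((n * num r) / den r) {{den-nz r}}

fP : Program → ℕ → Maybe ℕ
fP P n with firstFrac P n
... | just r  = just (apply r n)
... | nothing = nothing

lcmDen : Program → ℕ
lcmDen P = foldr (λ r acc → lcm (den r) acc) 1 P

private
  lcm-nz : ∀ m n → .{{NonZero m}} → .{{NonZero n}} → NonZero (lcm m n)
  lcm-nz m n = ≢-nonZero λ eq → ≢-nonZero⁻¹ (m * n) {{m*n≢0 m n}} (0∣⇒≡0 (∣-trans (zero∣ eq) (lcm-least {m} {n} (m∣m*n n) (n∣m*n m))))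
    where
    open import Relation.Binary.PropositionalEquality using (subst; sym)
    open import Data.Nat.Divisibility using (∣-refl)
    zero∣ : lcm m n ≡ 0 → 0 ∣ lcm m n
    zero∣ eq = subst (_∣ lcm m n) eq ∣-refl

lcmDen-nz : ∀ P → NonZero (lcmDen P)
lcmDen-nz [] = _
lcmDen-nz (r ∷ P) = lcm-nz (den r) (lcmDen P) {{den-nz r}} {{lcmDen-nz P}}

a′ : Program → ℕ → Maybe ℕ
a′ P n with firstFrac P n
... | just r  = just (num r * (lcmDen P / den r) {{den-nz r}})
... | nothing = nothing

b : Program → ℕ → Maybe ℕ
b P n with firstFrac P n
... | just r  = just (apply r n)
... | nothing = nothing

-- φ(n) ∈ {1..d} with n ≡ φ(n) mod d  (for n ≥ 1): φ(n) = ((n-1) mod d) + 1.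
φ : Program → ℕ → ℕ
φ P n = suc (((n ∸ 1) % lcmDen P) {{lcmDen-nz P}})

quot : Program → ℕ → ℕ
quot P n = ((n ∸ 1) / lcmDen P) {{lcmDen-nz P}}

rhs : Program → ℕ → Maybe ℕ
rhs P n with a′ P (φ P n) | b P (φ P n)
... | just a | just bb = just (quot P n * a + bb)
... | _      | _       = nothing

-- The first fraction applicable to n is decided by the divisibilities q_i ∣ n p_i,
-- which depend only on n mod d since every q_i divides d; so f_P(n) uses the same
-- fraction p/q as f_P(φ(n)). Writing n = ⌊(n-1)/d⌋ d + φ(n), the map n ↦ n p/q is
-- additive along multiples of d, adding p (d/q) = a'_{φ(n)} per period.
module Submission where

open import Defs
open import Data.Nat using (ℕ; _>_; suc; _+_; _*_; NonZero)
open import Data.Nat.Properties using (+-comm; +-suc; *-distribʳ-+)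
open import Data.Nat.DivMod using (_/_; _%_; m≡m%n+[m/n]*n; m*n/n≡m; +-distrib-/-∣ˡ)
open import Data.Nat.Divisibility using (_∣_; _∣?_; divides; divides-refl; ∣-trans; ∣m+n∣m⇒∣n; ∣m∣n⇒∣m+n; ∣m⇒∣m*n; ∣n⇒∣m*n)
open import Data.Nat.LCM using (m∣lcm[m,n]; n∣lcm[m,n])
open import Data.Nat.Tactic.RingSolver using (solve-∀)
open import Data.List using ([]; _∷_)
open import Data.List.Relation.Unary.All as All using (All; []; _∷_)
open import Data.List.Relation.Unary.Any using (here; there)
open import Data.List.Membership.Propositional using (_∈_)
open import Data.Maybe using (just; nothing; map)
open import Data.Maybe.Properties using (map-cong-local)
import Data.Maybe.Relation.Unary.All as Maybe
open import Function using (_⇔_; mk⇔; Equivalence)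
open import Relation.Nullary using (yes; no; contradiction)
open import Relation.Binary.PropositionalEquality using (_≡_; refl; sym; trans; cong; subst; module ≡-Reasoning)

suc≡[n/d]*d+suc[n%d] : ∀ d .{{_ : NonZero d}} n → suc n ≡ (n / d) * d + suc (n % d)
suc≡[n/d]*d+suc[n%d] d n = begin
  suc n                      ≡⟨ cong suc (m≡m%n+[m/n]*n n d) ⟩
  suc (n % d + (n / d) * d)  ≡⟨ cong suc (+-comm (n % d) _) ⟩
  suc ((n / d) * d + n % d)  ≡⟨ sym (+-suc _ _) ⟩
  (n / d) * d + suc (n % d)  ∎
  where open ≡-Reasoning

n≡quot*lcmDen+φ : ∀ P n → n > 0 → n ≡ quot P n * lcmDen P + φ P n
n≡quot*lcmDen+φ P (suc n) _ = suc≡[n/d]*d+suc[n%d] (lcmDen P) {{lcmDen-nz P}} n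

∣[k*d+m]*p⇔∣m*p : ∀ {e d} k m p → e ∣ d → e ∣ (k * d + m) * p ⇔ e ∣ m * p
∣[k*d+m]*p⇔∣m*p {e} {d} k m p e∣d = mk⇔
  (λ h → ∣m+n∣m⇒∣n (subst (e ∣_) distrib h) e∣kdp)
  (λ h → subst (e ∣_) (sym distrib) (∣m∣n⇒∣m+n e∣kdp h))
  where
  e∣kdp : e ∣ k * d * p
  e∣kdp = ∣m⇒∣m*n p (∣n⇒∣m*n k e∣d)
  distrib : (k * d + m) * p ≡ k * d * p + m * p
  distrib = *-distribʳ-+ p (k * d) m

firstFrac-periodic : ∀ {d} Q k m → All (λ r → den r ∣ d) Q →
                     firstFrac Q (k * d + m) ≡ firstFrac Q m
firstFrac-periodic [] k m [] = refl
firstFrac-periodic {d} (r ∷ Q) k m (q∣d ∷ Q∣d)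
  with den r ∣? ((k * d + m) * num r) | den r ∣? (m * num r)
... | yes _  | yes _  = refl
... | yes h  | no ¬h = contradiction (Equivalence.to (∣[k*d+m]*p⇔∣m*p k m (num r) q∣d) h) ¬h
... | no ¬h | yes h  = contradiction (Equivalence.from (∣[k*d+m]*p⇔∣m*p k m (num r) q∣d) h) ¬h
... | no _   | no _   = firstFrac-periodic Q k m Q∣d

firstFrac-∈ : ∀ Q m → Maybe.All (_∈ Q) (firstFrac Q m)
firstFrac-∈ [] m = Maybe.nothing
firstFrac-∈ (r ∷ Q) m with den r ∣? (m * num r)
... | yes _ = Maybe.just (here refl)
... | no _  = Maybe.map there (firstFrac-∈ Q m)

den∣lcmDen : ∀ P → All (λ r → den r ∣ lcmDen P) P
den∣lcmDen [] = []
den∣lcmDen (r ∷ P) = m∣lcm[m,n] (den r) (lcmDen P)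
  ∷ All.map (λ h → ∣-trans h (n∣lcm[m,n] (den r) (lcmDen P))) (den∣lcmDen P)

apply-periodic : ∀ {d} k m r → den r ∣ d →
                 apply r (k * d + m) ≡ k * (num r * (d / den r) {{den-nz r}}) + apply r m
apply-periodic k m r (divides c refl) = begin
  (k * (c * q) + m) * p / q            ≡⟨ cong (_/ q) (regroup k c q m p) ⟩
  (k * (p * c) * q + m * p) / q        ≡⟨ +-distrib-/-∣ˡ (m * p) (divides-refl (k * (p * c))) ⟩
  k * (p * c) * q / q + m * p / q      ≡⟨ cong (_+ m * p / q) (m*n/n≡m (k * (p * c)) q) ⟩
  k * (p * c) + m * p / q              ≡⟨ cong (λ x → k * (p * x) + m * p / q) (sym (m*n/n≡m c q)) ⟩
  k * (p * (c * q / q)) + m * p / q    ∎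
  where
  open ≡-Reasoning
  p = num r
  q = den r
  instance _ = den-nz r
  regroup : ∀ k c q m p → (k * (c * q) + m) * p ≡ k * (p * c) * q + m * p
  regroup = solve-∀

fP≡map-firstFrac : ∀ P n → fP P n ≡ map (λ r → apply r n) (firstFrac P n)
fP≡map-firstFrac P n with firstFrac P n
... | just _  = refl
... | nothing = refl

rhs≡map-firstFrac : ∀ P n → rhs P n ≡
  map (λ r → quot P n * (num r * (lcmDen P / den r) {{den-nz r}}) + apply r (φ P n)) (firstFrac P (φ P n))
rhs≡map-firstFrac P n with firstFrac P (φ P n)
... | just _  = refl
... | nothing = refl

lemma2 : (P : Program) (n : ℕ) → n > 0 → fP P n ≡ rhs P n
lemma2 P n n>0 = begin
  fP P n                                       ≡⟨ fP≡map-firstFrac P n ⟩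
  map (λ r → apply r n) (firstFrac P n)        ≡⟨ cong (map _) shift ⟩
  map (λ r → apply r n) (firstFrac P (φ P n))  ≡⟨ map-cong-local (Maybe.map apply-at-n (firstFrac-∈ P (φ P n))) ⟩
  map _ (firstFrac P (φ P n))                  ≡⟨ sym (rhs≡map-firstFrac P n) ⟩
  rhs P n                                      ∎
  where
  open ≡-Reasoning
  decomp : n ≡ quot P n * lcmDen P + φ P n
  decomp = n≡quot*lcmDen+φ P n n>0
  shift : firstFrac P n ≡ firstFrac P (φ P n)
  shift = trans (cong (firstFrac P) decomp) (firstFrac-periodic P (quot P n) (φ P n) (den∣lcmDen P))
  apply-at-n : ∀ {r} → r ∈ P →
            apply r n ≡ quot P n * (num r * (lcmDen P / den r) {{den-nz r}}) + apply r (φ P n)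
  apply-at-n {r} r∈P = trans (cong (apply r) decomp)
    (apply-periodic (quot P n) (φ P n) r (All.lookup (den∣lcmDen P) r∈P))
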